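{- Let $G$ be a spider with partition sets $K,S,R$, where $K$ is a clique and $S$ is a stable set. Then $\mathrm{hn}_{cc}(G)=2$ if $|K|\ge 3$ and $G$ is a fat spider, and $\mathrm{hn}_{cc}(G)=2+|S|$ otherwise.
   Context: Graphs are finite and simple. A graph $G$ is a spider if $V(G)$ can be partitioned into sets $K,S,R$ such that: $|K|=|S|\ge 2$ and $R$ may be empty; $K$ is a clique and $S$ is a stable set; every vertex of $R$ is adjacent to every vertex of $K$ and to no vertex of $S$; and there is a bijection $f:S\to K$ such that either $N(s)=\{f(s)\}$ for every $s\in S$ ($G$ is a thin spider) or $N(s)=K\setminus\{f(s)\}$ for every $s\in S$ ($G$ is a fat spider). A cycle is a closed walk $(v_1,\dots,v_q,v_1)$ with at least one edge in which the only repeated vertex is $v_1$. For $X\subseteq V(G)$, $I_{cc}(X)=X\cup\{x\in V(G): \text{there is a cycle } C \text{ of } G \text{ with } V(C)\setminus X=\{x\}\}$. A set $X$ is convex if $I_{cc}(X)=X$; $\mathrm{hull}(X)$ is the smallest convex set containing $X$; $X$ is a hull set if $\mathrm{hull}(X)=V(G)$; $\mathrm{hn}_{cc}(G)$ is the minimum cardinality of a hull set. -}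

module Defs where

open import Data.Nat using (ℕ; _≤_; _+_)
open import Data.Fin using (Fin)
open import Data.Fin.Subset using (Subset; _∈_; _∉_; _⊆_; ∣_∣)
open import Data.List using (List; _∷_; _∷ʳ_; length)
open import Data.List.Membership.Propositional using () renaming (_∈_ to _∈ₗ_)
open import Data.List.Relation.Unary.Linked using (Linked)
open import Data.List.Relation.Unary.Unique.Propositional using (Unique)
open import Data.Product using (Σ; _×_)
open import Data.Sum using (_⊎_)
open import Relation.Binary.PropositionalEquality using (_≡_; _≢_)
open import Relation.Nullary using (¬_)

record Graph : Set₁ where
  field
    n      : ℕ
    Adj    : Fin n → Fin n → Set
    sym    : ∀ {u v} → Adj u v → Adj v u
    irrefl : ∀ {v} → ¬ Adj v v

module _ (G : Graph) where
  open Graph G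

  record Cycle : Set where
    field
      start  : Fin n
      rest   : List (Fin n)
      long   : 2 ≤ length rest
      walk   : Linked Adj ((start ∷ rest) ∷ʳ start)
      simple : Unique (start ∷ rest)

  VC : Cycle → List (Fin n)
  VC C = Cycle.start C ∷ Cycle.rest C

  InIcc : Subset n → Fin n → Set
  InIcc X x = x ∈ X ⊎ Σ Cycle (λ C → x ∈ₗ VC C × x ∉ X ×
                 (∀ v → v ∈ₗ VC C → v ≢ x → v ∈ X))

  -- X is convex: I_cc(X) = X (the inclusion X ⊆ I_cc(X) is automatic)
  Convex : Subset n → Set
  Convex X = ∀ x → InIcc X x → x ∈ X

  -- hull(X) = V(G): the smallest convex set containing X is all of V(G),
  -- i.e. every convex superset of X is V(G).
  IsHullSet : Subset n → Set
  IsHullSet X = ∀ Y → X ⊆ Y → Convex Y → ∀ v → v ∈ Y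

  HullNumber : ℕ → Set
  HullNumber m = Σ (Subset n) (λ X → IsHullSet X × ∣ X ∣ ≡ m)
               × (∀ X → IsHullSet X → m ≤ ∣ X ∣)

data SpiderKind : Set where
  thin fat : SpiderKind

module _ (G : Graph) where
  open Graph G

  SpiderNbr : Subset n → (Fin n → Fin n) → SpiderKind → Fin n → Fin n → Set
  SpiderNbr K f thin s v = v ≡ f s
  SpiderNbr K f fat  s v = v ∈ K × v ≢ f s

  record IsSpider (K S R : Subset n) (f : Fin n → Fin n) (kind : SpiderKind) : Set where
    field
      partition : ∀ v → (v ∈ K × v ∉ S × v ∉ R)
                      ⊎ (v ∉ K × v ∈ S × v ∉ R)
                      ⊎ (v ∉ K × v ∉ S × v ∈ R)
      sameSize  : ∣ K ∣ ≡ ∣ S ∣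
      atLeast2  : 2 ≤ ∣ K ∣
      clique    : ∀ u v → u ∈ K → v ∈ K → u ≢ v → Adj u v
      stable    : ∀ u v → u ∈ S → v ∈ S → ¬ Adj u v
      R-K       : ∀ r k → r ∈ R → k ∈ K → Adj r k
      R-S       : ∀ r s → r ∈ R → s ∈ S → ¬ Adj r s
      f-maps    : ∀ s → s ∈ S → f s ∈ K
      f-inj     : ∀ s t → s ∈ S → t ∈ S → f s ≡ f t → s ≡ t
      f-surj    : ∀ k → k ∈ K → Σ (Fin n) (λ s → s ∈ S × f s ≡ k)
      nbhd      : ∀ s → s ∈ S → ∀ v →
                    (Adj s v → SpiderNbr K f kind s v) × (SpiderNbr K f kind s v → Adj s v)

-- A vertex lying on no cycle is never produced by the interval operator, so it belongs to every
-- hull set; conversely a set containing all such vertices and at most one further vertex is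
-- convex, because every cycle has two vertices besides the one it would add.  Hence if T is a set
-- of vertices on no cycle and T together with two more vertices is a hull set, the hull number is
-- 2 + |T|.  In a spider two vertices of K span, through triangles, all of K ∪ R.  When every
-- vertex of S has at most one neighbour (thin spiders, and fat spiders with |K| = 2) apply this
-- with T = S.  In a fat spider with |K| ≥ 3 each s ∈ S closes a triangle with two vertices of
-- K ∖ {f(s)}, so T = ∅ works.
module Submission where

open import Defs
open import Data.Nat using (_≤_; _+_; suc; z≤n; s≤s; _≤?_)
open import Data.Nat.Properties using (≤-trans)
open import Data.Fin using (Fin; zero; suc; _≟_)
open import Data.Fin.Properties using (suc-injective)
open import Data.Fin.Subset
  using (Subset; ∣_∣; _∈_; _∉_; _⊆_; inside; outside; ⁅_⁆; _∪_; ∁; _-_)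
open import Data.Fin.Subset.Properties
  using (_∈?_; ∉⊥; ∣⊥∣≡0; ∣⁅x⁆∣≡1; ∪-identityˡ; x∈p∪q⁺; x∈p∪q⁻; x∈⁅x⁆; x∈⁅y⁆⇒x≡y; x≢y⇒x∉⁅y⁆;
         x∈∁p⇒x∉p; x∉p⇒x∈∁p; x∉∁p⇒x∈p; x∈p∧x≢y⇒x∈p-y; x∈p⇒∣p-x∣<∣p∣; p⊂q⇒∣p∣<∣q∣)
open import Data.Vec.Base using (_∷_; here; there)
open import Data.List using (List; _∷_; []; _∷ʳ_; length)
open import Data.List.Membership.Propositional using () renaming (_∈_ to _∈ₗ_; _∉_ to _∉ₗ_)
open import Data.List.Relation.Unary.Any using (here; there)
open import Data.List.Relation.Unary.AllPairs using (_∷_; [])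
open import Data.List.Relation.Unary.All using (_∷_; [])
open import Data.List.Relation.Unary.Linked using (Linked; _∷_; [-])
open import Data.List.Relation.Unary.Unique.Propositional using (Unique)
open import Data.List.Relation.Unary.Unique.Propositional.Properties using (Unique[x∷xs]⇒x∉xs)
open import Data.Product using (_×_; _,_; Σ; ∃; ∃₂; proj₁; proj₂)
open import Data.Sum using (_⊎_; inj₁; inj₂; [_,_])
open import Function using (_∘_)
open import Relation.Binary.Core using (Rel)
open import Relation.Binary.Definitions using (DecidableEquality)
open import Relation.Binary.PropositionalEquality using (_≡_; _≢_; refl; sym; trans; cong; subst; ≢-sym)
open import Relation.Nullary using (¬_; yes; no)
open import Relation.Nullary.Decidable using (decidable-stable)
open import Relation.Nullary.Negation using (contradiction)

two-distinct-avoiding : ∀ {a p} {A : Set a} → DecidableEquality A → {P : A → Set p} {x y z : A} →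
                        P x → P y → P z → x ≢ y → x ≢ z → y ≢ z → ∀ v →
                        ∃₂ λ u w → P u × P w × u ≢ w × u ≢ v × w ≢ v
two-distinct-avoiding _≟_ {x = x} {y} px py pz x≢y x≢z y≢z v with v ≟ x | v ≟ y
... | yes refl | _        = _ , _ , py , pz , y≢z , ≢-sym x≢y , ≢-sym x≢z
... | no _     | yes refl = _ , _ , px , pz , x≢z , x≢y , ≢-sym y≢z
... | no v≢x   | no v≢y   = _ , _ , px , py , x≢y , ≢-sym v≢x , ≢-sym v≢y

∣⁅x⁆∪p∣≡1+∣p∣ : ∀ {n} (x : Fin n) {p : Subset n} → x ∉ p → ∣ ⁅ x ⁆ ∪ p ∣ ≡ suc ∣ p ∣
∣⁅x⁆∪p∣≡1+∣p∣ zero    {inside  ∷ p} x∉p = contradiction here x∉p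
∣⁅x⁆∪p∣≡1+∣p∣ zero    {outside ∷ p} _   = cong (suc ∘ ∣_∣) (∪-identityˡ p)
∣⁅x⁆∪p∣≡1+∣p∣ (suc x) {inside  ∷ p} x∉p = cong suc (∣⁅x⁆∪p∣≡1+∣p∣ x (x∉p ∘ there))
∣⁅x⁆∪p∣≡1+∣p∣ (suc x) {outside ∷ p} x∉p = ∣⁅x⁆∪p∣≡1+∣p∣ x (x∉p ∘ there)

∣⁅x⁆∪⁅y⁆∪p∣≡2+∣p∣ : ∀ {n} {x y : Fin n} {p : Subset n} → x ∉ p → y ∉ p → x ≢ y →
                    ∣ ⁅ x ⁆ ∪ ⁅ y ⁆ ∪ p ∣ ≡ 2 + ∣ p ∣
∣⁅x⁆∪⁅y⁆∪p∣≡2+∣p∣ {x = x} {y} {p} x∉p y∉p x≢y =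
  trans (∣⁅x⁆∪p∣≡1+∣p∣ x x∉⁅y⁆∪p) (cong suc (∣⁅x⁆∪p∣≡1+∣p∣ y y∉p))
  where
    x∉⁅y⁆∪p : x ∉ ⁅ y ⁆ ∪ p
    x∉⁅y⁆∪p = [ x≢y⇒x∉⁅y⁆ x≢y , x∉p ] ∘ x∈p∪q⁻ ⁅ y ⁆ p

-- p ⊂ q - x ⊂ q
2+∣p∣≤∣q∣ : ∀ {n} {p q : Subset n} {x y} → p ⊆ q → x ∈ q → y ∈ q → x ∉ p → y ∉ p → x ≢ y →
            2 + ∣ p ∣ ≤ ∣ q ∣
2+∣p∣≤∣q∣ {p = p} {q} {x} {y} p⊆q x∈q y∈q x∉p y∉p x≢y =
  ≤-trans (s≤s (p⊂q⇒∣p∣<∣q∣ (p⊆q-x , y , x∈p∧x≢y⇒x∈p-y y∈q (≢-sym x≢y) , y∉p)))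
          (x∈p⇒∣p-x∣<∣p∣ x∈q)
  where
    p⊆q-x : p ⊆ q - x
    p⊆q-x {z} z∈p = x∈p∧x≢y⇒x∈p-y (p⊆q z∈p) λ { refl → x∉p z∈p }

⊆-∉⇒∈ : ∀ {n} {p q : Subset n} → p ⊆ q → (∀ {x} → x ∉ p → x ∈ q) → ∀ x → x ∈ q
⊆-∉⇒∈ {p = p} p⊆q ∁p⊆q x with x ∈? p
... | yes x∈p = p⊆q x∈p
... | no x∉p  = ∁p⊆q x∉p

1≤∣p∣⇒nonempty : ∀ {n} (p : Subset n) → 1 ≤ ∣ p ∣ → ∃ (_∈ p)
1≤∣p∣⇒nonempty (inside  ∷ p) _  = zero , here
1≤∣p∣⇒nonempty (outside ∷ p) 1≤ with 1≤∣p∣⇒nonempty p 1≤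
... | x , x∈p = suc x , there x∈p

2≤∣p∣⇒distinct-pair : ∀ {n} (p : Subset n) → 2 ≤ ∣ p ∣ → ∃₂ λ x y → x ∈ p × y ∈ p × x ≢ y
2≤∣p∣⇒distinct-pair (inside ∷ p) (s≤s 1≤) with 1≤∣p∣⇒nonempty p 1≤
... | y , y∈p = zero , suc y , here , there y∈p , λ ()
2≤∣p∣⇒distinct-pair (outside ∷ p) 2≤ with 2≤∣p∣⇒distinct-pair p 2≤
... | x , y , x∈p , y∈p , x≢y = suc x , suc y , there x∈p , there y∈p , x≢y ∘ suc-injective

3≤∣p∣⇒distinct-triple : ∀ {n} (p : Subset n) → 3 ≤ ∣ p ∣ →
                        ∃ λ x → ∃₂ λ y z → x ∈ p × y ∈ p × z ∈ p × x ≢ y × x ≢ z × y ≢ z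
3≤∣p∣⇒distinct-triple (inside ∷ p) (s≤s 2≤) with 2≤∣p∣⇒distinct-pair p 2≤
... | y , z , y∈p , z∈p , y≢z =
  zero , suc y , suc z , here , there y∈p , there z∈p , (λ ()) , (λ ()) , y≢z ∘ suc-injective
3≤∣p∣⇒distinct-triple (outside ∷ p) 3≤ with 3≤∣p∣⇒distinct-triple p 3≤
... | x , y , z , x∈p , y∈p , z∈p , x≢y , x≢z , y≢z =
  suc x , suc y , suc z , there x∈p , there y∈p , there z∈p ,
  x≢y ∘ suc-injective , x≢z ∘ suc-injective , y≢z ∘ suc-injective

linked-last : ∀ {a ℓ} {A : Set a} {R : Rel A ℓ} {y x z : A} {xs : List A} →
              Linked R (y ∷ ((x ∷ xs) ∷ʳ z)) → ∃ λ w → w ∈ₗ x ∷ xs × R w z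
linked-last {xs = []}     (_ ∷ x-z ∷ [-]) = _ , here refl , x-z
linked-last {xs = _ ∷ _} (_ ∷ walk) with linked-last walk
... | w , w∈xs , w-z = w , there w∈xs , w-z

module _ (G : Graph) where
  open Graph G renaming (sym to Adj-sym)

  OnCycle : Fin n → Set
  OnCycle v = Σ (Cycle G) λ C → v ∈ₗ VC G C

  TwoNeighbours : Fin n → Set
  TwoNeighbours v = ∃₂ λ u w → Adj v u × Adj v w × u ≢ w

  AtMostOneNeighbour : Fin n → Set
  AtMostOneNeighbour v = ∀ {u w} → Adj v u → Adj v w → u ≡ w

  cycle-three-vertices : (C : Cycle G) → ∃ λ x → ∃₂ λ y z →
                         x ∈ₗ VC G C × y ∈ₗ VC G C × z ∈ₗ VC G C × x ≢ y × x ≢ z × y ≢ z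
  cycle-three-vertices record { rest = [] ; long = () }
  cycle-three-vertices record { rest = _ ∷ [] ; long = s≤s () }
  cycle-three-vertices record { rest = _ ∷ _ ∷ _ ; simple = (x≢y ∷ x≢z ∷ _) ∷ (y≢z ∷ _) ∷ _ } =
    _ , _ , _ , here refl , there (here refl) , there (there (here refl)) , x≢y , x≢z , y≢z

  -- The disjunction only excludes the closed walk y, x, y, whose middle vertex x has the single
  -- neighbour y.
  walk-interior-twoNeighbours : ∀ {y z v} {xs : List (Fin n)} → Linked Adj (y ∷ (xs ∷ʳ z)) →
                                Unique (y ∷ xs) → z ∉ₗ xs → 2 ≤ length xs ⊎ y ≢ z →
                                v ∈ₗ xs → TwoNeighbours v
  walk-interior-twoNeighbours {xs = _ ∷ []} _ _ _ (inj₁ (s≤s ())) (here refl)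
  walk-interior-twoNeighbours {xs = _ ∷ []} (y-x ∷ x-z ∷ [-]) _ _ (inj₂ y≢z) (here refl) =
    _ , _ , Adj-sym y-x , x-z , y≢z
  walk-interior-twoNeighbours {xs = _ ∷ _ ∷ _} (y-x ∷ x-x′ ∷ _) ((_ ∷ y≢x′ ∷ _) ∷ _) _ _ (here refl) =
    _ , _ , Adj-sym y-x , x-x′ , y≢x′
  walk-interior-twoNeighbours (_ ∷ walk) (_ ∷ unique) z∉x∷xs _ (there v∈xs) =
    walk-interior-twoNeighbours walk unique (z∉x∷xs ∘ there) (inj₂ λ { refl → z∉x∷xs (here refl) }) v∈xs

  onCycle⇒twoNeighbours : ∀ {v} → OnCycle v → TwoNeighbours v
  onCycle⇒twoNeighbours (record { rest = _ ∷ _ ∷ _ ; walk = s-x ∷ walk ; simple = _ ∷ unique } , here refl)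
    with linked-last walk
  ... | w , w∈xs , w-s = _ , _ , s-x , Adj-sym w-s , λ { refl → Unique[x∷xs]⇒x∉xs unique w∈xs }
  onCycle⇒twoNeighbours (record { rest = _ ∷ [] ; long = s≤s () } , here refl)
  onCycle⇒twoNeighbours (C , there v∈rest) =
    walk-interior-twoNeighbours walk simple (Unique[x∷xs]⇒x∉xs simple) (inj₁ long) v∈rest
    where open Cycle C

  atMostOneNeighbour⇒¬onCycle : ∀ {v} → AtMostOneNeighbour v → ¬ OnCycle v
  atMostOneNeighbour⇒¬onCycle ≤1 onC with onCycle⇒twoNeighbours onC
  ... | _ , _ , v-u , v-w , u≢w = u≢w (≤1 v-u v-w)

  convex-triangle : ∀ {Y u v w} → Convex G Y → u ∈ Y → v ∈ Y → Adj u v → Adj v w → Adj w u →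
                    u ≢ v → u ≢ w → v ≢ w → w ∈ Y
  convex-triangle {Y} {u} {v} {w} Y-convex u∈Y v∈Y u-v v-w w-u u≢v u≢w v≢w with w ∈? Y
  ... | yes w∈Y = w∈Y
  ... | no w∉Y = Y-convex w (inj₂ (triangle , there (there (here refl)) , w∉Y , others))
    where
      triangle : Cycle G
      triangle = record { start = u ; rest = v ∷ w ∷ [] ; long = s≤s (s≤s z≤n)
                        ; walk = u-v ∷ v-w ∷ w-u ∷ [-]
                        ; simple = (u≢v ∷ u≢w ∷ []) ∷ (v≢w ∷ []) ∷ [] ∷ [] }
      others : ∀ x → x ∈ₗ VC G triangle → x ≢ w → x ∈ Y
      others _ (here refl)                 _   = u∈Y
      others _ (there (here refl))         _   = v∈Y
      others _ (there (there (here refl))) x≢w = contradiction refl x≢w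

  ¬onCycle⇒∁⁅v⁆-convex : ∀ {v} → ¬ OnCycle v → Convex G (∁ ⁅ v ⁆)
  ¬onCycle⇒∁⁅v⁆-convex _     _ (inj₁ x∈Y) = x∈Y
  ¬onCycle⇒∁⁅v⁆-convex ¬onC x (inj₂ (C , x∈C , x∉Y , _))
    with refl ← x∈⁅y⁆⇒x≡y _ (x∉∁p⇒x∈p x∉Y) = contradiction (C , x∈C) ¬onC

  hullSet⇒¬onCycle⇒∈ : ∀ {X v} → IsHullSet G X → ¬ OnCycle v → v ∈ X
  hullSet⇒¬onCycle⇒∈ {X} {v} X-hull ¬onC = decidable-stable (v ∈? X) λ v∉X →
    x∈∁p⇒x∉p (X-hull _ (X⊆∁⁅v⁆ v∉X) (¬onCycle⇒∁⁅v⁆-convex ¬onC) v) (x∈⁅x⁆ v)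
    where
      X⊆∁⁅v⁆ : v ∉ X → X ⊆ ∁ ⁅ v ⁆
      X⊆∁⁅v⁆ v∉X x∈X = x∉p⇒x∈∁p (x≢y⇒x∉⁅y⁆ λ { refl → v∉X x∈X })

  module _ {T : Subset n} (T-offCycle : ∀ {t} → t ∈ T → ¬ OnCycle t) where

    small-convex : ∀ {X} → T ⊆ X → ¬ (2 + ∣ T ∣ ≤ ∣ X ∣) → Convex G X
    small-convex T⊆X small x (inj₁ x∈X) = x∈X
    small-convex T⊆X small x (inj₂ (C , _ , _ , others))
      with _ , _ , _ , x∈C , y∈C , z∈C , x≢y , x≢z , y≢z ← cycle-three-vertices C
      with u , w , u∈C , w∈C , u≢w , u≢x , w≢x ← two-distinct-avoiding _≟_ x∈C y∈C z∈C x≢y x≢z y≢z x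
      = contradiction (2+∣p∣≤∣q∣ T⊆X (others u u∈C u≢x) (others w w∈C w≢x)
                         (λ u∈T → T-offCycle u∈T (C , u∈C)) (λ w∈T → T-offCycle w∈T (C , w∈C)) u≢w)
                      small

    hullSet-lower-bound : ∀ {X a b} → IsHullSet G X → a ∉ T → b ∉ T → a ≢ b → 2 + ∣ T ∣ ≤ ∣ X ∣
    hullSet-lower-bound {X} {a} {b} X-hull a∉T b∉T a≢b = decidable-stable (2 + ∣ T ∣ ≤? ∣ X ∣) λ small →
      let everything = X-hull X (λ x∈X → x∈X) (small-convex T⊆X small)
      in small (2+∣p∣≤∣q∣ T⊆X (everything a) (everything b) a∉T b∉T a≢b)
      where
        T⊆X : T ⊆ X
        T⊆X t∈T = hullSet⇒¬onCycle⇒∈ X-hull (T-offCycle t∈T)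

    hullNumber≡2+∣T∣ : ∀ {a b} → a ∉ T → b ∉ T → a ≢ b → IsHullSet G (⁅ a ⁆ ∪ ⁅ b ⁆ ∪ T) →
                       HullNumber G (2 + ∣ T ∣)
    hullNumber≡2+∣T∣ a∉T b∉T a≢b hull =
      (_ , hull , ∣⁅x⁆∪⁅y⁆∪p∣≡2+∣p∣ a∉T b∉T a≢b) ,
      λ X X-hull → hullSet-lower-bound X-hull a∉T b∉T a≢b

module Spider {G : Graph} {K S R : Subset (Graph.n G)} {f : Fin (Graph.n G) → Fin (Graph.n G)}
              {kind : SpiderKind} (spider : IsSpider G K S R f kind) where
  open Graph G renaming (sym to Adj-sym)
  open IsSpider spider

  ∈K⇒∉S : ∀ {v} → v ∈ K → v ∉ S
  ∈K⇒∉S {v} v∈K with partition v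
  ... | inj₁ (_ , v∉S , _)    = v∉S
  ... | inj₂ (inj₁ (v∉K , _)) = contradiction v∈K v∉K
  ... | inj₂ (inj₂ (v∉K , _)) = contradiction v∈K v∉K

  ∈K⇒∉R : ∀ {v} → v ∈ K → v ∉ R
  ∈K⇒∉R {v} v∈K with partition v
  ... | inj₁ (_ , _ , v∉R)    = v∉R
  ... | inj₂ (inj₁ (v∉K , _)) = contradiction v∈K v∉K
  ... | inj₂ (inj₂ (v∉K , _)) = contradiction v∈K v∉K

  convex-⊇K∪R : ∀ {Y a b} → Convex G Y → a ∈ K → b ∈ K → a ≢ b → a ∈ Y → b ∈ Y →
                ∀ {v} → v ∉ S → v ∈ Y
  convex-⊇K∪R {Y} {a} {b} Y-convex a∈K b∈K a≢b a∈Y b∈Y {v} v∉S with partition v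
  ... | inj₂ (inj₁ (_ , v∈S , _)) = contradiction v∈S v∉S
  ... | inj₂ (inj₂ (_ , _ , v∈R)) =
    convex-triangle G Y-convex a∈Y b∈Y (clique a b a∈K b∈K a≢b) (Adj-sym (R-K v b v∈R b∈K))
      (R-K v a v∈R a∈K) a≢b (λ { refl → ∈K⇒∉R a∈K v∈R }) (λ { refl → ∈K⇒∉R b∈K v∈R })
  ... | inj₁ (v∈K , _) with v ≟ a | v ≟ b
  ...   | yes refl | _        = a∈Y
  ...   | no _     | yes refl = b∈Y
  ...   | no v≢a   | no v≢b   =
    convex-triangle G Y-convex a∈Y b∈Y (clique a b a∈K b∈K a≢b) (clique b v b∈K v∈K (≢-sym v≢b))
      (clique v a v∈K a∈K v≢a) a≢b (≢-sym v≢a) (≢-sym v≢b)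

  hullSet-⁅a⁆∪⁅b⁆∪T : ∀ {a b T} → a ∈ K → b ∈ K → a ≢ b →
                      (∀ {Y} → Convex G Y → (∀ {v} → v ∉ S → v ∈ Y) → T ⊆ Y → S ⊆ Y) →
                      IsHullSet G (⁅ a ⁆ ∪ ⁅ b ⁆ ∪ T)
  hullSet-⁅a⁆∪⁅b⁆∪T {a} {b} {T} a∈K b∈K a≢b S-closure Y ⊆Y Y-convex =
    ⊆-∉⇒∈ (S-closure Y-convex K∪R⊆Y (⊆Y ∘ x∈p∪q⁺ ∘ inj₂ ∘ x∈p∪q⁺ ∘ inj₂)) K∪R⊆Y
    where
      K∪R⊆Y : ∀ {v} → v ∉ S → v ∈ Y
      K∪R⊆Y = convex-⊇K∪R Y-convex a∈K b∈K a≢b (⊆Y (x∈p∪q⁺ (inj₁ (x∈⁅x⁆ a))))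
                (⊆Y (x∈p∪q⁺ (inj₂ (x∈p∪q⁺ (inj₁ (x∈⁅x⁆ b))))))

  hullNumber≡2+∣S∣ : (∀ {s} → s ∈ S → AtMostOneNeighbour G s) → HullNumber G (2 + ∣ S ∣)
  hullNumber≡2+∣S∣ S-leaves with a , b , a∈K , b∈K , a≢b ← 2≤∣p∣⇒distinct-pair K atLeast2 =
    hullNumber≡2+∣T∣ G (atMostOneNeighbour⇒¬onCycle G ∘ S-leaves) (∈K⇒∉S a∈K) (∈K⇒∉S b∈K) a≢b
      (hullSet-⁅a⁆∪⁅b⁆∪T a∈K b∈K a≢b λ _ _ S⊆Y → S⊆Y)

  convex-⊇S : 3 ≤ ∣ K ∣ → (∀ {s k} → s ∈ S → k ∈ K → k ≢ f s → Adj s k) →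
              ∀ {Y} → Convex G Y → (∀ {v} → v ∉ S → v ∈ Y) → S ⊆ Y
  convex-⊇S 3≤∣K∣ S-K Y-convex K∪R⊆Y {s} s∈S
    with _ , _ , _ , x∈K , y∈K , z∈K , x≢y , x≢z , y≢z ← 3≤∣p∣⇒distinct-triple K 3≤∣K∣
    with u , w , u∈K , w∈K , u≢w , u≢fs , w≢fs ← two-distinct-avoiding _≟_ x∈K y∈K z∈K x≢y x≢z y≢z (f s)
    = convex-triangle G Y-convex (K∪R⊆Y (∈K⇒∉S u∈K)) (K∪R⊆Y (∈K⇒∉S w∈K)) (clique u w u∈K w∈K u≢w)
        (Adj-sym (S-K s∈S w∈K w≢fs)) (S-K s∈S u∈K u≢fs) u≢w
        (λ { refl → ∈K⇒∉S u∈K s∈S }) (λ { refl → ∈K⇒∉S w∈K s∈S })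

  hullNumber≡2 : 3 ≤ ∣ K ∣ → (∀ {s k} → s ∈ S → k ∈ K → k ≢ f s → Adj s k) → HullNumber G 2
  hullNumber≡2 3≤∣K∣ S-K with a , b , a∈K , b∈K , a≢b ← 2≤∣p∣⇒distinct-pair K atLeast2 =
    subst (HullNumber G ∘ (2 +_)) (∣⊥∣≡0 n)
      (hullNumber≡2+∣T∣ G (λ t∈∅ → contradiction t∈∅ ∉⊥) ∉⊥ ∉⊥ a≢b
        (hullSet-⁅a⁆∪⁅b⁆∪T a∈K b∈K a≢b λ Y-convex K∪R⊆Y _ → convex-⊇S 3≤∣K∣ S-K Y-convex K∪R⊆Y))

  spiderNbr-unique : ∀ κ {s y z} → f s ∈ K → ¬ (κ ≡ fat × 3 ≤ ∣ K ∣) →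
                     SpiderNbr G K f κ s y → SpiderNbr G K f κ s z → y ≡ z
  spiderNbr-unique thin _ _ y≡fs z≡fs = trans y≡fs (sym z≡fs)
  spiderNbr-unique fat {s} {y} {z} fs∈K small (y∈K , y≢fs) (z∈K , z≢fs) =
    decidable-stable (y ≟ z) λ y≢z →
      small (refl , subst (λ k → 2 + k ≤ ∣ K ∣) (∣⁅x⁆∣≡1 (f s))
                      (2+∣p∣≤∣q∣ ⁅fs⁆⊆K y∈K z∈K (x≢y⇒x∉⁅y⁆ y≢fs) (x≢y⇒x∉⁅y⁆ z≢fs) y≢z))
    where
      ⁅fs⁆⊆K : ⁅ f s ⁆ ⊆ K
      ⁅fs⁆⊆K x∈⁅fs⁆ = subst (_∈ K) (sym (x∈⁅y⁆⇒x≡y (f s) x∈⁅fs⁆)) fs∈K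

  S-atMostOneNeighbour : ¬ (kind ≡ fat × 3 ≤ ∣ K ∣) → ∀ {s} → s ∈ S → AtMostOneNeighbour G s
  S-atMostOneNeighbour small {s} s∈S s-y s-z =
    spiderNbr-unique kind (f-maps s s∈S) small (proj₁ (nbhd s s∈S _) s-y) (proj₁ (nbhd s s∈S _) s-z)

lemma7 : (G : Graph) (K S R : Subset (Graph.n G)) (f : Fin (Graph.n G) → Fin (Graph.n G))
         (kind : SpiderKind) → IsSpider G K S R f kind →
         ((kind ≡ fat × 3 ≤ ∣ K ∣) → HullNumber G 2)
         × (¬ (kind ≡ fat × 3 ≤ ∣ K ∣) → HullNumber G (2 + ∣ S ∣))
lemma7 G K S R f kind spider = fat-large , hullNumber≡2+∣S∣ ∘ S-atMostOneNeighbour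
  where
    open Spider spider
    open IsSpider spider using (nbhd)
    fat-large : kind ≡ fat × 3 ≤ ∣ K ∣ → HullNumber G 2
    fat-large (refl , 3≤∣K∣) = hullNumber≡2 3≤∣K∣ λ s∈S k∈K k≢fs → proj₂ (nbhd _ s∈S _) (k∈K , k≢fs)
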